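{- For an integer $n\geq 3$, let $S_3(n)$ be the set of $n$-tuples $(1,\ldots,1,x,y,z)$ ($n-3$ ones) of positive integers with $2\leq x\leq y\leq z$ and $\sigma_2(1,\ldots,1,x,y,z)=\sigma_n(1,\ldots,1,x,y,z)$. Then: (1) For $n=3$ and for each integer $n\geq 5$ we have $|S_3(n)|\geq 3$. (2) For every integer $n\geq 3$, $$|S_3(n)|\geq\frac12\tau\!\left(\frac12(n-2)(3n-1)\right),$$ where $\tau(m)$ is the number of positive divisors of $m$. In particular, $\limsup_{n\to+\infty}|S_3(n)|=\limsup_{n\to+\infty}|S(n)|=+\infty$, where $S(n)$ is the set of $n$-tuples $(x_1,\ldots,x_n)$ of positive integers with $x_1\leq\cdots\leq x_n$ and $\sigma_2(x_1,\ldots,x_n)=\sigma_n(x_1,\ldots,x_n)$.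
   Context: $\sigma_k$ denotes the $k$-th elementary symmetric polynomial in $n$ variables. -}

module Defs where

open import Data.Nat using (ℕ; zero; suc; _+_; _*_; _∸_; _≤_; _/_)
open import Data.Nat.Divisibility using (_∣_; _∣?_)
open import Data.List using (List; []; _∷_; _++_; replicate; length; filter; upTo; map)
open import Data.List.Relation.Unary.All using (All)
open import Data.List.Relation.Unary.Linked using (Linked)
open import Data.List.Relation.Unary.Unique.Propositional using (Unique)
open import Data.Vec using (Vec; toList)
open import Data.Product using (Σ; ∃; _×_)
open import Relation.Binary.PropositionalEquality using (_≡_)

σ : ℕ → List ℕ → ℕ
σ zero    _        = 1
σ (suc k) []       = 0
σ (suc k) (x ∷ xs) = x * σ k xs + σ (suc k) xs

tuple3 : ℕ → ℕ → ℕ → ℕ → List ℕ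
tuple3 n x y z = replicate (n ∸ 3) 1 ++ (x ∷ y ∷ z ∷ [])

S₃ : ℕ → List ℕ → Set
S₃ n t = ∃ λ x → ∃ λ y → ∃ λ z →
  t ≡ tuple3 n x y z × 2 ≤ x × x ≤ y × y ≤ z × σ 2 t ≡ σ n t

S : (n : ℕ) → Vec ℕ n → Set
S n v = All (1 ≤_) (toList v) × Linked _≤_ (toList v) × σ 2 (toList v) ≡ σ n (toList v)

AtLeast : {A : Set} → ℕ → (A → Set) → Set
AtLeast {A} k P = Σ (List A) λ l → Unique l × All P l × k ≤ length l

-- τ m : number of positive divisors of m (for m ≥ 1)
τ : ℕ → ℕ
τ m = length (filter (_∣? m) (map suc (upTo m)))

module Submission where

-- With m = n − 3 ones, σ₂ = σₙ for (1,…,1,x,y,z) reads, after doubling,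
--   m² + 2m(x + y + z) + 2(xy + yz + zx) = 2xyz + m.
-- For x = 2, y = m + 2 + d, z = m + 2 + e this is equivalent to de = (m + 1)(3m + 8)/2 = (n − 2)(3n − 1)/2,
-- so every factorisation d ≤ e of that number gives an element of S₃(n); there are ⌈τ/2⌉ of them, since
-- d ↦ N/d maps the divisors above √N injectively to those below.  Taking n = 2F + 2 makes the number
-- F(6F + 5), and choosing F divisible by 1, …, 2K forces at least K elements; these tuples are sorted,
-- so they also lie in S(n).  For n ≥ 5, besides the factorisation 1·N, each residue of m modulo 4
-- admits an explicit second factorisation and an explicit solution with x = 3 or 4.

open import Defs
open import Data.Nat using (ℕ; zero; suc; _+_; _*_; _∸_; _≤_; _<_; _/_; _!; z≤n; s≤s; _≤?_; NonZero; >-nonZero; >-nonZero⁻¹; ≢-nonZero⁻¹)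
open import Data.Nat.Properties
open import Data.Nat.Divisibility
  using (_∣_; _∣?_; ∣⇒≤; ∣-trans; m∣m*n; n∣m*n; ∣m⇒∣m*n; m≤n⇒m!∣n!; 0∣⇒≡0)
open import Data.Nat.DivMod using (m*[n/m]≡n; m*n/n≡m; /-monoˡ-≤; m<n*o⇒m/o<n)
open import Data.Product.Properties using (,-injectiveˡ)
open import Data.Nat.Tactic.RingSolver using (solve-∀)
open import Data.Product using (∃; _×_; _,_; proj₁; proj₂)
open import Data.Vec as Vec using (Vec; toList)
open import Data.List using (List; []; _∷_; _++_; replicate; length; filter; upTo; map)
open import Data.List.Properties
  using (length-map; length-upTo; length-++; length-replicate; length-removeAt′; ++-cancelˡ)
open import Data.List.Membership.Propositional using (_∈_; _─_)
open import Data.List.Membership.Propositional.Properties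
  using (∈-filter⁺; ∈-filter⁻; ∈-map⁺; ∈-map⁻; ∈-upTo⁺; ∈-upTo⁻)
open import Data.List.Relation.Unary.Any using (here; there)
open import Data.List.Relation.Unary.All as All using (All; []; _∷_)
import Data.List.Relation.Unary.All.Properties as All
open import Data.List.Relation.Unary.AllPairs using ([]; _∷_)
open import Data.List.Relation.Unary.Linked using (Linked; [-]; _∷_)
open import Data.List.Relation.Unary.Unique.Propositional using (Unique)
import Data.List.Relation.Unary.Unique.Propositional.Properties as Unique
open import Relation.Binary.PropositionalEquality
open import Relation.Nullary using (yes; no; contradiction)
open import Relation.Unary using (Decidable)
open import Relation.Unary.Properties using (∁?)

-- Counting elements of lists

module _ {A : Set} where

  ∈-─⁺ : ∀ {a b : A} ys (a∈ys : a ∈ ys) → b ∈ ys → b ≢ a → b ∈ ys ─ a∈ys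
  ∈-─⁺ (y ∷ ys) (here refl) (here refl) b≢a = contradiction refl b≢a
  ∈-─⁺ (y ∷ ys) (here refl) (there b∈ys) _  = b∈ys
  ∈-─⁺ (y ∷ ys) (there _)   (here b≡y)   _  = here b≡y
  ∈-─⁺ (y ∷ ys) (there a∈ys) (there b∈ys) b≢a = there (∈-─⁺ ys a∈ys b∈ys b≢a)

  Unique-⊆⇒length≤ : ∀ {xs ys : List A} → Unique xs → (∀ {a} → a ∈ xs → a ∈ ys) → length xs ≤ length ys
  Unique-⊆⇒length≤ {[]}     _            _    = z≤n
  Unique-⊆⇒length≤ {x ∷ xs} {ys} (x∉xs ∷ u) xs⊆ys = begin
    suc (length xs)         ≤⟨ s≤s (Unique-⊆⇒length≤ u xs⊆ys─x) ⟩
    suc (length (ys ─ x∈ys)) ≡⟨ length-removeAt′ ys _ ⟨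
    length ys               ∎
    where
    open ≤-Reasoning
    x∈ys = xs⊆ys (here refl)
    xs⊆ys─x : ∀ {a} → a ∈ xs → a ∈ ys ─ x∈ys
    xs⊆ys─x a∈xs = ∈-─⁺ ys x∈ys (xs⊆ys (there a∈xs)) (λ a≡x → All.lookup x∉xs a∈xs (sym a≡x))

  length-filter-∁ : ∀ {P : A → Set} (P? : Decidable P) xs →
    length (filter P? xs) + length (filter (∁? P?) xs) ≡ length xs
  length-filter-∁ P? []       = refl
  length-filter-∁ P? (x ∷ xs) with P? x
  ... | yes _ = cong suc (length-filter-∁ P? xs)
  ... | no  _ = trans (+-suc _ _) (cong suc (length-filter-∁ P? xs))

module _ {A B : Set} {P : A → Set} (f : A → B) (f-inj : ∀ {a b} → P a → P b → f a ≡ f b → a ≡ b) where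

  Unique-map⁺ : ∀ {xs} → All P xs → Unique xs → Unique (map f xs)
  Unique-map⁺ []         []           = []
  Unique-map⁺ (pa ∷ pas) (a∉ ∷ u) =
    All.map⁺ (All.zipWith (λ (pb , a≢b) fa≡fb → a≢b (f-inj pa pb fa≡fb)) (pas , a∉)) ∷ Unique-map⁺ pas u

  AtLeast-map : ∀ {Q : B → Set} {k} → (∀ {a} → P a → Q (f a)) → AtLeast k P → AtLeast k Q
  AtLeast-map {k = k} P⇒Q (l , u , ps , k≤) =
    map f l , Unique-map⁺ ps u , All.map⁺ (All.map P⇒Q ps) , subst (k ≤_) (sym (length-map f l)) k≤

AtLeast-weaken : ∀ {A : Set} {P : A → Set} {j k} → j ≤ k → AtLeast k P → AtLeast j P
AtLeast-weaken j≤k (l , u , ps , k≤) = l , u , ps , ≤-trans j≤k k≤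

-- Divisors and factorisations

divisors : ℕ → List ℕ
divisors N = filter (_∣? N) (map suc (upTo N))

Factorisation : ℕ → ℕ × ℕ → Set
Factorisation N (d , e) = d * e ≡ N × d ≤ e

module Divisors (N : ℕ) {{_ : NonZero N}} where

  ∈-divisors⁻ : ∀ {d} → d ∈ divisors N → d ∣ N × 0 < d
  ∈-divisors⁻ d∈ with ∈-filter⁻ (_∣? N) {xs = map suc (upTo N)} d∈
  ... | d∈suc , d∣N with ∈-map⁻ suc d∈suc
  ...   | _ , _ , refl = d∣N , s≤s z≤n

  ∈-divisors⁺ : ∀ {d} → d ∣ N → 0 < d → d ∈ divisors N
  ∈-divisors⁺ {suc d} d∣N _ = ∈-filter⁺ (_∣? N) (∈-map⁺ suc (∈-upTo⁺ (∣⇒≤ d∣N))) d∣N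

  -- N / d, with junk value 0 at d = 0
  cofactor : ℕ → ℕ
  cofactor zero    = 0
  cofactor (suc d) = N / suc d

  *-cofactor : ∀ {d} → d ∣ N → d * cofactor d ≡ N
  *-cofactor {zero}  d∣N = sym (0∣⇒≡0 d∣N)
  *-cofactor {suc d} d∣N = m*[n/m]≡n d∣N

  cofactor-∣ : ∀ {d} → d ∣ N → cofactor d ∣ N
  cofactor-∣ {d} d∣N = subst (cofactor d ∣_) (*-cofactor d∣N) (n∣m*n d)

  cofactor-positive : ∀ {d} → d ∣ N → 0 < cofactor d
  cofactor-positive {d} d∣N = n≢0⇒n>0 λ q≡0 →
    ≢-nonZero⁻¹ N (trans (sym (*-cofactor d∣N)) (trans (cong (d *_) q≡0) (*-zeroʳ d)))

  cofactor-injective : ∀ {a b} → a ∣ N → b ∣ N → cofactor a ≡ cofactor b → a ≡ b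
  cofactor-injective {a} {b} a∣N b∣N qa≡qb = *-cancelʳ-≡ a b (cofactor a) {{>-nonZero (cofactor-positive a∣N)}}
    (trans (*-cofactor a∣N) (trans (sym (*-cofactor b∣N)) (cong (b *_) (sym qa≡qb))))

  small? : Decidable (λ d → d * d ≤ N)
  small? d = d * d ≤? N

  small large : List ℕ
  small = filter small? (divisors N)
  large = filter (∁? small?) (divisors N)

  ∈-large⇒cofactor∈small : ∀ {d} → d ∈ large → cofactor d ∈ small
  ∈-large⇒cofactor∈small {d} d∈ with ∈-filter⁻ (∁? small?) {xs = divisors N} d∈
  ... | d∈divs , d²≰N with ∈-divisors⁻ d∈divs
  ...   | d∣N , _ = ∈-filter⁺ small? (∈-divisors⁺ (cofactor-∣ d∣N) (cofactor-positive d∣N)) q²≤N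
    where
    q = cofactor d
    q<d : q < d
    q<d = *-cancelˡ-< d q d (subst (_< d * d) (sym (*-cofactor d∣N)) (≰⇒> d²≰N))
    q²≤N : q * q ≤ N
    q²≤N = begin
      q * q ≤⟨ *-monoʳ-≤ q (<⇒≤ q<d) ⟩
      q * d ≡⟨ *-comm q d ⟩
      d * q ≡⟨ *-cofactor d∣N ⟩
      N     ∎
      where open ≤-Reasoning

  Unique-divisors : Unique (divisors N)
  Unique-divisors = Unique.filter⁺ (_∣? N) (Unique.map⁺ suc-injective (Unique.upTo⁺ N))

  length-large≤small : length large ≤ length small
  length-large≤small = subst (_≤ length small) (length-map cofactor large)
    (Unique-⊆⇒length≤
      (Unique-map⁺ cofactor cofactor-injective (All.tabulate large-divisor) (Unique.filter⁺ (∁? small?) Unique-divisors))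
      λ q∈ → let (d , d∈ , q≡) = ∈-map⁻ cofactor q∈ in subst (_∈ small) (sym q≡) (∈-large⇒cofactor∈small d∈))
    where
    large-divisor : ∀ {d} → d ∈ large → d ∣ N
    large-divisor d∈ = proj₁ (∈-divisors⁻ (proj₁ (∈-filter⁻ (∁? small?) {xs = divisors N} d∈)))

  ∈-small⇒Factorisation : ∀ {d} → d ∈ small → Factorisation N (d , cofactor d)
  ∈-small⇒Factorisation {d} d∈ with ∈-filter⁻ small? {xs = divisors N} d∈
  ... | d∈divs , d²≤N with ∈-divisors⁻ d∈divs
  ...   | d∣N , 0<d = *-cofactor d∣N ,
          *-cancelˡ-≤ d {{>-nonZero 0<d}} (subst (d * d ≤_) (sym (*-cofactor d∣N)) d²≤N)

  half-τ≤length-small : (τ N + 1) / 2 ≤ length small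
  half-τ≤length-small = <⇒≤pred (m<n*o⇒m/o<n {τ N + 1} {suc s} {2} (begin-strict
    τ N + 1     ≡⟨ cong (_+ 1) (length-filter-∁ small? (divisors N)) ⟨
    s + b + 1   ≤⟨ +-monoˡ-≤ 1 (+-monoʳ-≤ s length-large≤small) ⟩
    s + s + 1   <⟨ n<1+n _ ⟩
    suc (s + s + 1) ≡⟨ double s ⟩
    suc s * 2   ∎))
    where
    open ≤-Reasoning
    s = length small
    b = length large
    double : ∀ s → suc (s + s + 1) ≡ suc s * 2
    double = solve-∀

  atLeast-factorisations : AtLeast ((τ N + 1) / 2) (Factorisation N)
  atLeast-factorisations =
    map (λ d → d , cofactor d) small ,
    Unique.map⁺ ,-injectiveˡ (Unique.filter⁺ small? Unique-divisors) ,
    All.map⁺ (All.tabulate ∈-small⇒Factorisation) ,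
    subst ((τ N + 1) / 2 ≤_) (sym (length-map _ small)) half-τ≤length-small

  ≤τ-if-divisible-up-to : ∀ K → (∀ d → 0 < d → d ≤ K → d ∣ N) → K ≤ τ N
  ≤τ-if-divisible-up-to K divisible = subst (_≤ τ N) (trans (length-map suc (upTo K)) (length-upTo K))
    (Unique-⊆⇒length≤ (Unique.map⁺ suc-injective (Unique.upTo⁺ K)) λ a∈ →
      let (i , i∈ , a≡) = ∈-map⁻ suc a∈
      in subst (_∈ divisors N) (sym a≡) (∈-divisors⁺ (divisible (suc i) (s≤s z≤n) (∈-upTo⁻ i∈)) (s≤s z≤n)))

∣n! : ∀ {d n} → 0 < d → d ≤ n → d ∣ n !
∣n! {suc d} _ d≤n = ∣-trans (m∣m*n (d !)) (m≤n⇒m!∣n! d≤n)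

-- Elementary symmetric functions of (1,…,1,x,y,z)

σ-vanishes : ∀ l k → length l < k → σ k l ≡ 0
σ-vanishes []       (suc k)       _       = refl
σ-vanishes (x ∷ xs) (suc (suc k)) (s≤s p)
  rewrite σ-vanishes xs (suc k) p | σ-vanishes xs (suc (suc k)) (m<n⇒m<1+n p) =
  trans (+-identityʳ _) (*-zeroʳ x)

σ₁-ones++ : ∀ m l → σ 1 (replicate m 1 ++ l) ≡ m + σ 1 l
σ₁-ones++ zero    l = refl
σ₁-ones++ (suc m) l = cong suc (σ₁-ones++ m l)

σ₂-ones++ : ∀ m l → 2 * σ 2 (replicate m 1 ++ l) + m ≡ m * m + 2 * m * σ 1 l + 2 * σ 2 l
σ₂-ones++ zero    l = +-identityʳ _
σ₂-ones++ (suc m) l = begin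
  2 * (1 * σ 1 (replicate m 1 ++ l) + σ 2 (replicate m 1 ++ l)) + suc m
    ≡⟨ cong (λ s → 2 * (1 * s + σ 2 (replicate m 1 ++ l)) + suc m) (σ₁-ones++ m l) ⟩
  2 * (1 * (m + σ 1 l) + σ 2 (replicate m 1 ++ l)) + suc m
    ≡⟨ step m (σ 1 l) (σ 2 (replicate m 1 ++ l)) ⟩
  (2 * σ 2 (replicate m 1 ++ l) + m) + 2 * m + 1 + 2 * σ 1 l
    ≡⟨ cong (λ t → t + 2 * m + 1 + 2 * σ 1 l) (σ₂-ones++ m l) ⟩
  m * m + 2 * m * σ 1 l + 2 * σ 2 l + 2 * m + 1 + 2 * σ 1 l
    ≡⟨ regroup m (σ 1 l) (σ 2 l) ⟩
  suc m * suc m + 2 * suc m * σ 1 l + 2 * σ 2 l ∎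
  where
  open ≡-Reasoning
  step : ∀ m s t → 2 * (1 * (m + s) + t) + suc m ≡ (2 * t + m) + 2 * m + 1 + 2 * s
  step = solve-∀
  regroup : ∀ m s t → m * m + 2 * m * s + 2 * t + 2 * m + 1 + 2 * s ≡ suc m * suc m + 2 * suc m * s + 2 * t
  regroup = solve-∀

σ-top-ones++ : ∀ m l → σ (m + length l) (replicate m 1 ++ l) ≡ σ (length l) l
σ-top-ones++ zero    l = refl
σ-top-ones++ (suc m) l = begin
  1 * σ (m + length l) (replicate m 1 ++ l) + σ (suc (m + length l)) (replicate m 1 ++ l)
    ≡⟨ cong₂ (λ a b → 1 * a + b) (σ-top-ones++ m l) (σ-vanishes (replicate m 1 ++ l) _ short) ⟩
  1 * σ (length l) l + 0
    ≡⟨ trans (+-identityʳ _) (*-identityˡ _) ⟩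
  σ (length l) l ∎
  where
  open ≡-Reasoning
  short : length (replicate m 1 ++ l) < suc (m + length l)
  short = s≤s (≤-reflexive (trans (length-++ (replicate m 1)) (cong (_+ length l) (length-replicate m))))

σ₁-triple : ∀ x y z → σ 1 (x ∷ y ∷ z ∷ []) ≡ x + y + z
σ₁-triple = expanded
  where
  expanded : ∀ x y z → x * 1 + (y * 1 + (z * 1 + 0)) ≡ x + y + z
  expanded = solve-∀

σ₂-triple : ∀ x y z → σ 2 (x ∷ y ∷ z ∷ []) ≡ x * y + y * z + z * x
σ₂-triple = expanded
  where
  expanded : ∀ x y z → x * (y * 1 + (z * 1 + 0)) + (y * (z * 1 + 0) + (z * 0 + 0)) ≡ x * y + y * z + z * x
  expanded = solve-∀

σ₃-triple : ∀ x y z → σ 3 (x ∷ y ∷ z ∷ []) ≡ x * y * z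
σ₃-triple = expanded
  where
  expanded : ∀ x y z → x * (y * (z * 1 + 0) + (z * 0 + 0)) + (y * (z * 0 + 0) + (z * 0 + 0)) ≡ x * y * z
  expanded = solve-∀

σ₂≡σₙ-tuple3 : ∀ m x y z →
  m * m + 2 * m * (x + y + z) + 2 * (x * y + y * z + z * x) ≡ 2 * (x * y * z) + m →
  σ 2 (tuple3 (3 + m) x y z) ≡ σ (3 + m) (tuple3 (3 + m) x y z)
σ₂≡σₙ-tuple3 m x y z eq = *-cancelˡ-≡ _ _ 2 (+-cancelʳ-≡ m _ _ (begin
  2 * σ 2 t + m
    ≡⟨ σ₂-ones++ m (x ∷ y ∷ z ∷ []) ⟩
  m * m + 2 * m * σ 1 (x ∷ y ∷ z ∷ []) + 2 * σ 2 (x ∷ y ∷ z ∷ [])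
    ≡⟨ cong₂ (λ a b → m * m + 2 * m * a + 2 * b) (σ₁-triple x y z) (σ₂-triple x y z) ⟩
  m * m + 2 * m * (x + y + z) + 2 * (x * y + y * z + z * x)
    ≡⟨ eq ⟩
  2 * (x * y * z) + m
    ≡⟨ cong (λ a → 2 * a + m) (sym (trans top (σ₃-triple x y z))) ⟩
  2 * σ (3 + m) t + m ∎))
  where
  open ≡-Reasoning
  t = tuple3 (3 + m) x y z
  top : σ (3 + m) t ≡ σ 3 (x ∷ y ∷ z ∷ [])
  top = trans (cong (λ k → σ k t) (+-comm 3 m)) (σ-top-ones++ m (x ∷ y ∷ z ∷ []))

tuple3-injective : ∀ m {x y z x′ y′ z′} → tuple3 (3 + m) x y z ≡ tuple3 (3 + m) x′ y′ z′ →
  x ≡ x′ × y ≡ y′ × z ≡ z′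
tuple3-injective m eq with ++-cancelˡ (replicate m 1) _ _ eq
... | refl = refl , refl , refl

-- Solutions of σ₂ = σₙ

-- (m + 1)(3m + 8)/2, defined through its differences so that no division occurs
halfProduct : ℕ → ℕ
halfProduct zero    = 4
halfProduct (suc m) = 3 * m + 7 + halfProduct m

2*halfProduct : ∀ m → 2 * halfProduct m ≡ suc m * (3 * m + 8)
2*halfProduct zero    = refl
2*halfProduct (suc m) = begin
  2 * (3 * m + 7 + halfProduct m)      ≡⟨ *-distribˡ-+ 2 (3 * m + 7) (halfProduct m) ⟩
  2 * (3 * m + 7) + 2 * halfProduct m  ≡⟨ cong (2 * (3 * m + 7) +_) (2*halfProduct m) ⟩
  2 * (3 * m + 7) + suc m * (3 * m + 8) ≡⟨ next m ⟩
  suc (suc m) * (3 * suc m + 8)        ∎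
  where
  open ≡-Reasoning
  next : ∀ m → 2 * (3 * m + 7) + suc m * (3 * m + 8) ≡ suc (suc m) * (3 * suc m + 8)
  next = solve-∀

halfProduct-unique : ∀ m {a} → 2 * a ≡ suc m * (3 * m + 8) → a ≡ halfProduct m
halfProduct-unique m eq = *-cancelˡ-≡ _ _ 2 (trans eq (sym (2*halfProduct m)))

factorisation-σ₂≡σₙ : ∀ m {d e} → d * e ≡ halfProduct m →
  σ 2 (tuple3 (3 + m) 2 (m + 2 + d) (m + 2 + e)) ≡ σ (3 + m) (tuple3 (3 + m) 2 (m + 2 + d) (m + 2 + e))
factorisation-σ₂≡σₙ m {d} {e} de≡h = σ₂≡σₙ-tuple3 m 2 (m + 2 + d) (m + 2 + e) (+-cancelʳ-≡ (2 * (d * e)) _ _ (begin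
  lhs + 2 * (d * e)                        ≡⟨ balanced m d e ⟩
  rhs + suc m * (3 * m + 8)                ≡⟨ cong (rhs +_) (sym (2*halfProduct m)) ⟩
  rhs + 2 * halfProduct m                  ≡⟨ cong (λ a → rhs + 2 * a) (sym de≡h) ⟩
  rhs + 2 * (d * e)                        ∎))
  where
  open ≡-Reasoning
  y = m + 2 + d
  z = m + 2 + e
  lhs = m * m + 2 * m * (2 + y + z) + 2 * (2 * y + y * z + z * 2)
  rhs = 2 * (2 * y * z) + m
  -- lhs − rhs = (m + 1)(3m + 8) − 2de, with both sides moved so that no subtraction occurs
  balanced : ∀ m d e → let y = m + 2 + d ; z = m + 2 + e in
    m * m + 2 * m * (2 + y + z) + 2 * (2 * y + y * z + z * 2) + 2 * (d * e) ≡ 2 * (2 * y * z) + m + suc m * (3 * m + 8)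
  balanced = solve-∀

factorisation-S₃ : ∀ m {d e} → d * e ≡ halfProduct m → d ≤ e → S₃ (3 + m) (tuple3 (3 + m) 2 (m + 2 + d) (m + 2 + e))
factorisation-S₃ m {d} {e} de≡h d≤e =
  2 , m + 2 + d , m + 2 + e , refl , ≤-refl , ≤-trans (m≤n+m 2 m) (m≤m+n (m + 2) d) , +-monoʳ-≤ (m + 2) d≤e ,
  factorisation-σ₂≡σₙ m de≡h

halfProduct-nonZero : ∀ m → NonZero (halfProduct m)
halfProduct-nonZero zero    = _
halfProduct-nonZero (suc m) = >-nonZero (≤-trans (s≤s z≤n) (≤-trans (m≤n+m 7 (3 * m)) (m≤m+n (3 * m + 7) (halfProduct m))))

halfProduct-formula : ∀ m → (3 + m ∸ 2) * (3 * (3 + m) ∸ 1) / 2 ≡ halfProduct m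
halfProduct-formula m = begin
  suc m * (3 * (3 + m) ∸ 1) / 2 ≡⟨ cong (λ a → suc m * (a ∸ 1) / 2) (triple m) ⟩
  suc m * (3 * m + 8) / 2       ≡⟨ cong (_/ 2) (trans (sym (2*halfProduct m)) (*-comm 2 (halfProduct m))) ⟩
  halfProduct m * 2 / 2         ≡⟨ m*n/n≡m (halfProduct m) 2 ⟩
  halfProduct m                 ∎
  where
  open ≡-Reasoning
  triple : ∀ m → 3 * (3 + m) ≡ suc (3 * m + 8)
  triple = solve-∀

S₃-from-factorisations : ∀ m → AtLeast ((τ (halfProduct m) + 1) / 2) (S₃ (3 + m))
S₃-from-factorisations m = AtLeast-map {P = Factorisation (halfProduct m)} tuple injective (λ (de≡h , d≤e) → factorisation-S₃ m de≡h d≤e)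
  (Divisors.atLeast-factorisations (halfProduct m) {{halfProduct-nonZero m}})
  where
  tuple : ℕ × ℕ → List ℕ
  tuple (d , e) = tuple3 (3 + m) 2 (m + 2 + d) (m + 2 + e)
  injective : ∀ {p q} → Factorisation (halfProduct m) p → Factorisation (halfProduct m) q → tuple p ≡ tuple q → p ≡ q
  injective _ _ eq with tuple3-injective m eq
  ... | _ , y≡y′ , z≡z′ = cong₂ _,_ (+-cancelˡ-≡ (m + 2) _ _ y≡y′) (+-cancelˡ-≡ (m + 2) _ _ z≡z′)

S₃-lower-bound : ∀ n → 3 ≤ n → AtLeast ((τ ((n ∸ 2) * (3 * n ∸ 1) / 2) + 1) / 2) (S₃ n)
S₃-lower-bound (suc (suc (suc m))) _ =
  subst (λ h → AtLeast ((τ h + 1) / 2) (S₃ (3 + m))) (sym (halfProduct-formula m)) (S₃-from-factorisations m)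
S₃-lower-bound (suc zero)       (s≤s ())
S₃-lower-bound (suc (suc zero)) (s≤s (s≤s ()))

three-solutions : ∀ m {d e x y z} → 2 ≤ d → d ≤ e → 2 * (d * e) ≡ suc m * (3 * m + 8) →
  3 ≤ x → x ≤ y → y ≤ z → m * m + 2 * m * (x + y + z) + 2 * (x * y + y * z + z * x) ≡ 2 * (x * y * z) + m →
  AtLeast 3 (S₃ (3 + m))
three-solutions m {d} {e} {x} {y} {z} 2≤d d≤e de-eq 3≤x x≤y y≤z xyz-eq =
  tA ∷ tB ∷ tC ∷ [] ,
  ((tA≢tB ∷ tA≢tC ∷ []) ∷ (tB≢tC ∷ []) ∷ [] ∷ []) ,
  factorisation-S₃ m (*-identityˡ _) (>-nonZero⁻¹ _ {{halfProduct-nonZero m}}) ∷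
  factorisation-S₃ m (halfProduct-unique m de-eq) d≤e ∷
  (x , y , z , refl , ≤-trans (n≤1+n 2) 3≤x , x≤y , y≤z , σ₂≡σₙ-tuple3 m x y z xyz-eq) ∷ [] ,
  ≤-refl
  where
  tA = tuple3 (3 + m) 2 (m + 2 + 1) (m + 2 + halfProduct m)
  tB = tuple3 (3 + m) 2 (m + 2 + d) (m + 2 + e)
  tC = tuple3 (3 + m) x y z
  tA≢tB : tA ≢ tB
  tA≢tB eq = <⇒≢ 2≤d (+-cancelˡ-≡ (m + 2) _ _ (proj₁ (proj₂ (tuple3-injective m eq))))
  tA≢tC : tA ≢ tC
  tA≢tC eq = <⇒≢ 3≤x (proj₁ (tuple3-injective m eq))
  tB≢tC : tB ≢ tC
  tB≢tC eq = <⇒≢ 3≤x (proj₁ (tuple3-injective m eq))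

three-solutions-even : ∀ k → AtLeast 3 (S₃ (3 + 2 * suc k))
three-solutions-even k =
  three-solutions (2 * suc k) {3 + 2 * k} {3 + 2 * k + (k + 4)} {3} {3 + (2 * k + 1)} {3 + (2 * k + 1) + (k + 5)}
    (s≤s (s≤s z≤n)) (m≤m+n _ _) (product k) ≤-refl (m≤m+n _ _) (m≤m+n _ _) (cubic k)
  where
  product : ∀ k → 2 * ((3 + 2 * k) * (3 + 2 * k + (k + 4))) ≡ suc (2 * suc k) * (3 * (2 * suc k) + 8)
  product = solve-∀
  cubic : ∀ k → let m = 2 * suc k ; y = 3 + (2 * k + 1) ; z = 3 + (2 * k + 1) + (k + 5) in
    m * m + 2 * m * (3 + y + z) + 2 * (3 * y + y * z + z * 3) ≡ 2 * (3 * y * z) + m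
  cubic = solve-∀

three-solutions-1mod4 : ∀ i → AtLeast 3 (S₃ (3 + (1 + 2 * (2 * suc i))))
three-solutions-1mod4 i =
  three-solutions (1 + 2 * (2 * suc i)) {3 + 2 * i} {3 + 2 * i + (10 * i + 20)} {4} {4 + 2 * i} {4 + 2 * i + (6 * i + 18)}
    (s≤s (s≤s z≤n)) (m≤m+n _ _) (product i) (n≤1+n 3) (m≤m+n _ _) (m≤m+n _ _) (cubic i)
  where
  product : ∀ i → 2 * ((3 + 2 * i) * (3 + 2 * i + (10 * i + 20))) ≡ suc (1 + 2 * (2 * suc i)) * (3 * (1 + 2 * (2 * suc i)) + 8)
  product = solve-∀
  cubic : ∀ i → let m = 1 + 2 * (2 * suc i) ; y = 4 + 2 * i ; z = 4 + 2 * i + (6 * i + 18) in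
    m * m + 2 * m * (4 + y + z) + 2 * (4 * y + y * z + z * 4) ≡ 2 * (4 * y * z) + m
  cubic = solve-∀

three-solutions-3mod4 : ∀ j → AtLeast 3 (S₃ (3 + (1 + 2 * (1 + 2 * j))))
three-solutions-3mod4 j =
  three-solutions (1 + 2 * (1 + 2 * j)) {2 + 2 * j} {2 + 2 * j + (10 * j + 15)} {3} {3 + (2 * j + 1)}
    {3 + (2 * j + 1) + (8 * j * j + 23 * j + 14)}
    (s≤s (s≤s z≤n)) (m≤m+n _ _) (product j) ≤-refl (m≤m+n _ _) (m≤m+n _ _) (cubic j)
  where
  product : ∀ j → 2 * ((2 + 2 * j) * (2 + 2 * j + (10 * j + 15))) ≡ suc (1 + 2 * (1 + 2 * j)) * (3 * (1 + 2 * (1 + 2 * j)) + 8)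
  product = solve-∀
  cubic : ∀ j → let m = 1 + 2 * (1 + 2 * j) ; y = 3 + (2 * j + 1) ; z = 3 + (2 * j + 1) + (8 * j * j + 23 * j + 14) in
    m * m + 2 * m * (3 + y + z) + 2 * (3 * y + y * z + z * 3) ≡ 2 * (3 * y * z) + m
  cubic = solve-∀

data Parity : ℕ → Set where
  even : ∀ k → Parity (2 * k)
  odd  : ∀ k → Parity (1 + 2 * k)

parity : ∀ n → Parity n
parity zero = even 0
parity (suc n) with parity n
... | even k = odd k
... | odd k  = subst Parity (cong suc (+-suc k (k + 0))) (even (suc k))

three-solutions-n≥5 : ∀ n → 5 ≤ n → AtLeast 3 (S₃ n)
three-solutions-n≥5 (suc (suc (suc m))) (s≤s (s≤s (s≤s 2≤m))) with parity m
... | even zero    = contradiction 2≤m λ ()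
... | even (suc k) = three-solutions-even k
... | odd k with parity k
...   | even zero    = contradiction 2≤m λ { (s≤s ()) }
...   | even (suc i) = three-solutions-1mod4 i
...   | odd j        = three-solutions-3mod4 j

three-solutions-n≡3 : AtLeast 3 (S₃ 3)
three-solutions-n≡3 =
  tuple3 3 3 3 3 ∷ tuple3 3 2 4 4 ∷ tuple3 3 2 3 6 ∷ [] ,
  (((λ ()) ∷ (λ ()) ∷ []) ∷ ((λ ()) ∷ []) ∷ [] ∷ []) ,
  (3 , 3 , 3 , refl , s≤s (s≤s z≤n) , ≤-refl , ≤-refl , refl) ∷
  (2 , 4 , 4 , refl , ≤-refl , s≤s (s≤s z≤n) , ≤-refl , refl) ∷
  (2 , 3 , 6 , refl , ≤-refl , s≤s (s≤s z≤n) , s≤s (s≤s (s≤s z≤n)) , refl) ∷ [] ,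
  ≤-refl

halfProduct-at-2F+2 : ∀ F → (2 * F + 2 ∸ 2) * (3 * (2 * F + 2) ∸ 1) / 2 ≡ F * (5 + 6 * F)
halfProduct-at-2F+2 F = begin
  (2 * F + 2 ∸ 2) * (3 * (2 * F + 2) ∸ 1) / 2 ≡⟨ cong₂ (λ a b → a * (b ∸ 1) / 2) (m+n∸n≡m (2 * F) 2) (triple F) ⟩
  2 * F * (5 + 6 * F) / 2                     ≡⟨ cong (_/ 2) (swap F) ⟩
  F * (5 + 6 * F) * 2 / 2                     ≡⟨ m*n/n≡m (F * (5 + 6 * F)) 2 ⟩
  F * (5 + 6 * F)                             ∎
  where
  open ≡-Reasoning
  triple : ∀ F → 3 * (2 * F + 2) ≡ suc (5 + 6 * F)
  triple = solve-∀
  swap : ∀ F → 2 * F * (5 + 6 * F) ≡ F * (5 + 6 * F) * 2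
  swap = solve-∀

≤[n+1]/2 : ∀ {m n} → 2 * m ≤ n → m ≤ (n + 1) / 2
≤[n+1]/2 {m} {n} 2m≤n = begin
  m             ≡⟨ m*n/n≡m m 2 ⟨
  m * 2 / 2     ≤⟨ /-monoˡ-≤ 2 (≤-trans (≤-reflexive (*-comm m 2)) (≤-trans 2m≤n (m≤m+n n 1))) ⟩
  (n + 1) / 2   ∎
  where open ≤-Reasoning

S₃-unbounded : ∀ K N → ∃ λ n → N ≤ n × AtLeast K (S₃ n)
S₃-unbounded K N = 2 * F + 2 , N≤n ,
  AtLeast-weaken (≤[n+1]/2 2K≤τ)
    (subst (λ h → AtLeast ((τ h + 1) / 2) (S₃ (2 * F + 2))) (halfProduct-at-2F+2 F) (S₃-lower-bound (2 * F + 2) 3≤n))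
  where
  F = (2 * K) ! * suc N
  instance
    F≢0 : NonZero F
    F≢0 = m*n≢0 ((2 * K) !) (suc N) {{(2 * K) !≢0}}
  h = F * (5 + 6 * F)
  2K≤τ : 2 * K ≤ τ h
  2K≤τ = Divisors.≤τ-if-divisible-up-to h {{m*n≢0 F (5 + 6 * F)}} (2 * K)
    λ d 0<d d≤2K → ∣m⇒∣m*n (5 + 6 * F) (∣-trans (∣n! 0<d d≤2K) (m∣m*n (suc N)))
  3≤n : 3 ≤ 2 * F + 2
  3≤n = ≤-trans (n≤1+n 3) (+-monoˡ-≤ 2 (*-monoʳ-≤ 2 (>-nonZero⁻¹ F)))
  N≤n : N ≤ 2 * F + 2
  N≤n = begin
    N         ≤⟨ n≤1+n N ⟩
    suc N     ≤⟨ m≤n*m (suc N) ((2 * K) !) {{(2 * K) !≢0}} ⟩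
    F         ≤⟨ m≤n*m F 2 ⟩
    2 * F     ≤⟨ m≤m+n (2 * F) 2 ⟩
    2 * F + 2 ∎
    where open ≤-Reasoning

-- truncates or pads with zeros; only applied to lists of length n
toVec : ∀ n → List ℕ → Vec ℕ n
toVec zero    _        = Vec.[]
toVec (suc n) []       = 0 Vec.∷ toVec n []
toVec (suc n) (x ∷ xs) = x Vec.∷ toVec n xs

toList-toVec : ∀ {n} xs → length xs ≡ n → toList (toVec n xs) ≡ xs
toList-toVec []       refl = refl
toList-toVec (x ∷ xs) refl = cong (x ∷_) (toList-toVec xs refl)

Linked-ones++ : ∀ k {x l} → 1 ≤ x → Linked _≤_ (x ∷ l) → Linked _≤_ (replicate k 1 ++ x ∷ l)
Linked-ones++ zero          _   sorted = sorted
Linked-ones++ (suc zero)    1≤x sorted = 1≤x ∷ sorted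
Linked-ones++ (suc (suc k)) 1≤x sorted = ≤-refl ∷ Linked-ones++ (suc k) 1≤x sorted

S₃-length : ∀ {n t} → 3 ≤ n → S₃ n t → length t ≡ n
S₃-length {n} 3≤n (x , y , z , refl , _) =
  trans (length-++ (replicate (n ∸ 3) 1)) (trans (cong (_+ 3) (length-replicate (n ∸ 3))) (m∸n+n≡m 3≤n))

S₃⇒S : ∀ {n t} → 3 ≤ n → S₃ n t → S n (toVec n t)
S₃⇒S {n} 3≤n t∈S₃@(x , y , z , refl , 2≤x , x≤y , y≤z , σ₂≡σₙ) =
  subst (λ l → All (1 ≤_) l × Linked _≤_ l × σ 2 l ≡ σ n l) (sym (toList-toVec _ (S₃-length 3≤n t∈S₃)))
    (All.++⁺ (All.replicate⁺ (n ∸ 3) ≤-refl) (1≤x ∷ 1≤y ∷ ≤-trans 1≤y y≤z ∷ []) ,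
     Linked-ones++ (n ∸ 3) 1≤x (x≤y ∷ y≤z ∷ [-]) ,
     σ₂≡σₙ)
  where
  1≤x = ≤-trans (n≤1+n 1) 2≤x
  1≤y = ≤-trans 1≤x x≤y

AtLeast-S₃⇒S : ∀ {n K} → 3 ≤ n → AtLeast K (S₃ n) → AtLeast K (S n)
AtLeast-S₃⇒S {n} 3≤n = AtLeast-map {P = S₃ n} (toVec n) toVec-injective {Q = S n} (S₃⇒S 3≤n)
  where
  toVec-injective : ∀ {t t′} → S₃ n t → S₃ n t′ → toVec n t ≡ toVec n t′ → t ≡ t′
  toVec-injective t∈ t′∈ eq = trans (sym (toList-toVec _ (S₃-length 3≤n t∈)))
    (trans (cong toList eq) (toList-toVec _ (S₃-length 3≤n t′∈)))

S-unbounded : ∀ K N → ∃ λ n → N ≤ n × AtLeast K (S n)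
S-unbounded K N =
  let n , 3+N≤n , atLeast = S₃-unbounded K (3 + N)
  in n , ≤-trans (m≤n+m N 3) 3+N≤n , AtLeast-S₃⇒S (≤-trans (m≤m+n 3 N) 3+N≤n) atLeast

theorem3p2 :
    (AtLeast 3 (S₃ 3) × (∀ n → 5 ≤ n → AtLeast 3 (S₃ n)))
    × (∀ n → 3 ≤ n → AtLeast ((τ ((n ∸ 2) * (3 * n ∸ 1) / 2) + 1) / 2) (S₃ n))
    × (∀ K N → ∃ λ n → N ≤ n × AtLeast K (S₃ n))
    × (∀ K N → ∃ λ n → N ≤ n × AtLeast K (S n))
theorem3p2 = (three-solutions-n≡3 , three-solutions-n≥5) , S₃-lower-bound , S₃-unbounded , S-unbounded
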